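{- For $k\geq 3$ and $n\geq 2$, $p_k(n)\geq 1$. Moreover, for $k\geq 3$ and $n\geq 12$, $p_k(n)\geq\lfloor n/6\rfloor$.
   Context: For $k\geq 2$, $p_k(n)$ denotes the number of partitions of $n$ with at most $k$ parts in which the largest part appears at least twice ($p_k(0)=1$, $p_k(n)=0$ for $n=1$ or $n<0$). -}

module Defs where

open import Data.Nat using (ℕ; zero; suc; _∸_; _≤_; _≤?_; _≟_)
open import Data.List using (List; []; _∷_; [_]; map; concatMap; filter; length; upTo)
open import Data.Unit using (⊤)
open import Data.Empty using (⊥)
open import Data.Product using (_×_)
open import Relation.Nullary using (Dec; yes; no)
open import Relation.Nullary.Decidable using (_×-dec_)
open import Relation.Binary.PropositionalEquality using (_≡_)

-- A partition is represented as a non-increasing list of positive parts.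
-- partitionsBounded f n m : all partitions of n into parts of size ≤ m,
-- each listed once as a non-increasing list (f is fuel; f = n suffices,
-- since every part is ≥ 1).
partitionsBounded : ℕ → ℕ → ℕ → List (List ℕ)
partitionsBounded _       zero    _ = [ [] ]
partitionsBounded zero    (suc _) _ = []
partitionsBounded (suc f) (suc n) m =
  concatMap (λ j → map (j ∷_) (partitionsBounded f (suc n ∸ j) j))
            (filter (λ j → j ≤? suc n) (map suc (upTo m)))

partitions : ℕ → List (List ℕ)
partitions n = partitionsBounded n n n

-- For a non-increasing list, the largest part is the head; it appears at
-- least twice iff the first two entries agree.  The empty partition is
-- admitted (convention p_k(0) = 1).
LargestTwice : List ℕ → Set
LargestTwice []          = ⊤
LargestTwice (x ∷ [])    = ⊥
LargestTwice (x ∷ y ∷ _) = x ≡ y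

largestTwice? : (l : List ℕ) → Dec (LargestTwice l)
largestTwice? []          = yes _
largestTwice? (x ∷ [])    = no (λ ())
largestTwice? (x ∷ y ∷ _) = x ≟ y

Counted : ℕ → List ℕ → Set
Counted k l = (length l ≤ k) × LargestTwice l

counted? : (k : ℕ) → (l : List ℕ) → Dec (Counted k l)
counted? k l = (length l ≤? k) ×-dec largestTwice? l

p : ℕ → ℕ → ℕ
p k n = length (filter (counted? k) (partitions n))

-- For 2a ≤ n ≤ 3a the parts a, a, n − 2a (the last dropped when it is 0)
-- form a partition with at most three parts whose largest part a appears
-- twice.  Sorting the partitions of n by largest part, p_k(n) is at least
-- the number of integers a in [n/3, n/2]; writing n = 6q + r, the interval
-- (2q + ⌊r/2⌋, 3q + ⌊r/2⌋] is such a range of length q = ⌊n/6⌋, and for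
-- n ≥ 2 the integer ⌊n/2⌋ alone already lies in it.
module Submission where

open import Defs
open import Data.Nat using (ℕ; zero; suc; _+_; _*_; _∸_; _≤_; _<_; _/_; _%_; z≤n; s≤s; _≤?_)
open import Data.Nat.Properties
open import Data.Nat.DivMod using (m≡m%n+[m/n]*n; m%n<n; m/n*n≤m)
open import Data.Nat.Tactic.RingSolver using (solve-∀)
open import Data.Product using (_×_; _,_)
open import Data.List using (List; []; _∷_; [_]; _++_; map; concatMap; filter; length; upTo; applyUpTo)
open import Data.Nat.ListAction using (sum)
open import Data.List.Properties using (filter-++; length-++; map-upTo; filter-all; map-applyUpTo)
open import Data.List.Membership.Propositional using (_∈_; lose)
open import Data.List.Membership.Propositional.Properties
  using (∈-filter⁺; ∈-map⁺; ∈-concatMap⁺; ∈-upTo⁺; ∈-length)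
open import Data.List.Relation.Unary.Any using (here)
open import Data.List.Relation.Unary.All.Properties using (applyUpTo⁺₁)
open import Relation.Nullary using (Dec)
open import Relation.Binary.PropositionalEquality using (_≡_; refl; sym; trans; cong; subst; module ≡-Reasoning)

length-filter-concatMap : ∀ {A B : Set} {P : B → Set} (P? : ∀ x → Dec (P x)) (f : A → List B) xs →
  length (filter P? (concatMap f xs)) ≡ sum (map (λ x → length (filter P? (f x))) xs)
length-filter-concatMap P? f []       = refl
length-filter-concatMap P? f (x ∷ xs) = begin
  length (filter P? (f x ++ concatMap f xs))
    ≡⟨ cong length (filter-++ P? (f x) (concatMap f xs)) ⟩
  length (filter P? (f x) ++ filter P? (concatMap f xs))
    ≡⟨ length-++ (filter P? (f x)) ⟩
  length (filter P? (f x)) + length (filter P? (concatMap f xs))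
    ≡⟨ cong (length (filter P? (f x)) +_) (length-filter-concatMap P? f xs) ⟩
  sum (map (λ x → length (filter P? (f x))) (x ∷ xs)) ∎
  where open ≡-Reasoning

count≤sum-applyUpTo : ∀ (f : ℕ → ℕ) c m N → c + m ≤ N →
  (∀ i → i < m → 1 ≤ f (c + i)) → m ≤ sum (applyUpTo f N)
count≤sum-applyUpTo f zero    zero    N       _          _   = z≤n
count≤sum-applyUpTo f zero    (suc m) (suc N) (s≤s m≤N)  pos =
  +-mono-≤ (pos 0 (s≤s z≤n))
           (count≤sum-applyUpTo (λ i → f (suc i)) 0 m N m≤N (λ i i<m → pos (suc i) (s≤s i<m)))
count≤sum-applyUpTo f (suc c) m       (suc N) (s≤s c+m≤N) pos =
  ≤-trans (count≤sum-applyUpTo (λ i → f (suc i)) c m N c+m≤N pos) (m≤n+m _ (f 0))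

-- The partitions of suc n (not n) with largest part j.
partitionsWithLargest : ℕ → ℕ → List (List ℕ)
partitionsWithLargest n j = map (j ∷_) (partitionsBounded n (suc n ∸ j) j)

partitions-suc : ∀ n → partitions (suc n) ≡ concatMap (partitionsWithLargest n) (applyUpTo suc (suc n))
partitions-suc n = cong (concatMap (partitionsWithLargest n)) (begin
  filter (_≤? suc n) (map suc (upTo (suc n)))  ≡⟨ cong (filter (_≤? suc n)) (map-upTo suc (suc n)) ⟩
  filter (_≤? suc n) (applyUpTo suc (suc n))   ≡⟨ filter-all (_≤? suc n) (applyUpTo⁺₁ suc (suc n) (λ i<n → i<n)) ⟩
  applyUpTo suc (suc n)                        ∎)
  where open ≡-Reasoning

∷-∈-partitionsBounded : ∀ {f n b j l} → j < b → j < suc n →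
  l ∈ partitionsBounded f (suc n ∸ suc j) (suc j) → suc j ∷ l ∈ partitionsBounded (suc f) (suc n) b
∷-∈-partitionsBounded {n = n} {j = j} j<b j<n l∈ =
  ∈-concatMap⁺ _ (lose (∈-filter⁺ (_≤? suc n) (∈-map⁺ suc (∈-upTo⁺ j<b)) j<n) (∈-map⁺ (suc j ∷_) l∈))

trivialPartition : ℕ → List ℕ
trivialPartition zero    = []
trivialPartition (suc t) = [ suc t ]

length-trivialPartition : ∀ t → length (trivialPartition t) ≤ 1
length-trivialPartition zero    = z≤n
length-trivialPartition (suc t) = s≤s z≤n

trivialPartition-∈ : ∀ {f t b} → t ≤ f → t ≤ b → trivialPartition t ∈ partitionsBounded f t b
trivialPartition-∈ {t = zero}                 _         _   = here refl
trivialPartition-∈ {suc f} {suc t} {suc b} (s≤s t≤f) (s≤s t≤b) =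
  ∷-∈-partitionsBounded (s≤s t≤b) ≤-refl
    (subst (λ r → [] ∈ partitionsBounded f r (suc t)) (sym (n∸n≡0 t)) (here refl))

twoLargest-∈ : ∀ {n a t} → t ≤ a → a + (a + t) ≡ suc n →
  a ∷ a ∷ trivialPartition t ∈ partitionsWithLargest n a
twoLargest-∈ {a = zero}  z≤n ()
twoLargest-∈ {a = suc a} {t} t≤a refl
  rewrite m+n∸m≡n a (suc (a + t)) | +-suc a (a + t) =
  ∈-map⁺ (suc a ∷_) (∷-∈-partitionsBounded ≤-refl (s≤s (m≤m+n a t))
    (subst (λ r → trivialPartition t ∈ partitionsBounded (a + (a + t)) r (suc a)) (sym (m+n∸m≡n a t))
      (trivialPartition-∈ (≤-trans (m≤n+m t a) (m≤n+m (a + t) a)) t≤a)))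

pWithLargest : ℕ → ℕ → ℕ → ℕ
pWithLargest k n j = length (filter (counted? k) (partitionsWithLargest n j))

p-suc : ∀ k n → p k (suc n) ≡ sum (applyUpTo (λ i → pWithLargest k n (suc i)) (suc n))
p-suc k n = begin
  p k (suc n)
    ≡⟨ cong (λ ps → length (filter (counted? k) ps)) (partitions-suc n) ⟩
  length (filter (counted? k) (concatMap (partitionsWithLargest n) (applyUpTo suc (suc n))))
    ≡⟨ length-filter-concatMap (counted? k) (partitionsWithLargest n) (applyUpTo suc (suc n)) ⟩
  sum (map (pWithLargest k n) (applyUpTo suc (suc n)))
    ≡⟨ cong sum (map-applyUpTo suc (pWithLargest k n) (suc n)) ⟩
  sum (applyUpTo (λ i → pWithLargest k n (suc i)) (suc n)) ∎
  where open ≡-Reasoning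

1≤pWithLargest : ∀ {k n a} → 3 ≤ k → 2 * a ≤ suc n → suc n ≤ 3 * a → 1 ≤ pWithLargest k n a
1≤pWithLargest {k} {n} {a} 3≤k 2a≤n n≤3a with m≤n⇒∃[o]m+o≡n 2a≤n
... | t , 2a+t≡n =
  ∈-length (∈-filter⁺ (counted? k) (twoLargest-∈ t≤a (trans (a+[a+t]≡2a+t a t) 2a+t≡n))
                      (≤-trans (s≤s (s≤s (length-trivialPartition t))) 3≤k , refl))
  where
  a+[a+t]≡2a+t : ∀ a t → a + (a + t) ≡ 2 * a + t
  a+[a+t]≡2a+t = solve-∀
  t≤a : t ≤ a
  t≤a = +-cancelˡ-≤ (2 * a) t a (begin
    2 * a + t  ≡⟨ 2a+t≡n ⟩
    suc n      ≤⟨ n≤3a ⟩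
    3 * a      ≡⟨ +-comm a (2 * a) ⟩
    2 * a + a  ∎)
    where open ≤-Reasoning

interval≤p : ∀ {k} n c m → 3 ≤ k → n ≤ 3 * suc c → 2 * (c + m) ≤ n → m ≤ p k n
interval≤p zero    c m _ _ 2[c+m]≤0 = ≤-trans (≤-trans (m≤n+m m c) (≤-trans (m≤m+n (c + m) _) 2[c+m]≤0)) z≤n
interval≤p {k} (suc n) c m 3≤k n≤3[1+c] 2[c+m]≤n =
  subst (m ≤_) (sym (p-suc k n)) (count≤sum-applyUpTo (λ i → pWithLargest k n (suc i)) c m (suc n) c+m≤n positive)
  where
  c+m≤n : c + m ≤ suc n
  c+m≤n = ≤-trans (m≤m+n (c + m) _) 2[c+m]≤n
  positive : ∀ i → i < m → 1 ≤ pWithLargest k n (suc (c + i))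
  positive i i<m = 1≤pWithLargest {a = suc (c + i)} 3≤k
    (≤-trans (*-monoʳ-≤ 2 (subst (_≤ c + m) (+-suc c i) (+-monoʳ-≤ c i<m))) 2[c+m]≤n)
    (≤-trans n≤3[1+c] (*-monoʳ-≤ 3 (s≤s (m≤m+n c i))))

2*[m/2]≤m : ∀ m → 2 * (m / 2) ≤ m
2*[m/2]≤m m = subst (_≤ m) (*-comm (m / 2) 2) (m/n*n≤m m 2)

m≤1+2*[m/2] : ∀ m → m ≤ 1 + 2 * (m / 2)
m≤1+2*[m/2] m = begin
  m                    ≡⟨ m≡m%n+[m/n]*n m 2 ⟩
  m % 2 + m / 2 * 2    ≤⟨ +-mono-≤ (≤-pred (m%n<n m 2)) (≤-reflexive (*-comm (m / 2) 2)) ⟩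
  1 + 2 * (m / 2)      ∎
  where open ≤-Reasoning

1≤p : ∀ k n → 3 ≤ k → 2 ≤ n → 1 ≤ p k n
1≤p k zero          _   ()
1≤p k (suc zero)    _   (s≤s ())
1≤p k (suc (suc n)) 3≤k _ = interval≤p (2 + n) (n / 2) 1 3≤k upper lower
  where
  open ≤-Reasoning
  upper : 2 + n ≤ 3 * suc (n / 2)
  upper = begin
    2 + n                ≤⟨ +-monoʳ-≤ 2 (m≤1+2*[m/2] n) ⟩
    3 + 2 * (n / 2)      ≤⟨ +-monoʳ-≤ 3 (*-monoˡ-≤ (n / 2) {2} {3} (s≤s (s≤s z≤n))) ⟩
    3 + 3 * (n / 2)      ≡⟨ *-suc 3 (n / 2) ⟨
    3 * suc (n / 2)      ∎
  lower : 2 * (n / 2 + 1) ≤ 2 + n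
  lower = begin
    2 * (n / 2 + 1)      ≡⟨ cong (2 *_) (+-comm (n / 2) 1) ⟩
    2 * suc (n / 2)      ≡⟨ *-suc 2 (n / 2) ⟩
    2 + 2 * (n / 2)      ≤⟨ +-monoʳ-≤ 2 (2*[m/2]≤m n) ⟩
    2 + n                ∎

n/6≤p : ∀ k n → 3 ≤ k → n / 6 ≤ p k n
n/6≤p k n 3≤k = interval≤p n (2 * q + h) q 3≤k upper lower
  where
  open ≤-Reasoning
  q r h : ℕ
  q = n / 6
  r = n % 6
  h = r / 2
  upper : n ≤ 3 * suc (2 * q + h)
  upper = begin
    n                              ≡⟨ m≡m%n+[m/n]*n n 6 ⟩
    r + q * 6                      ≤⟨ +-monoˡ-≤ (q * 6) (m≤1+2*[m/2] r) ⟩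
    1 + 2 * h + q * 6              ≤⟨ m≤m+n _ (2 + h) ⟩
    1 + 2 * h + q * 6 + (2 + h)    ≡⟨ identity q h ⟩
    3 * suc (2 * q + h)            ∎
    where
    identity : ∀ q h → 1 + 2 * h + q * 6 + (2 + h) ≡ 3 * suc (2 * q + h)
    identity = solve-∀
  lower : 2 * (2 * q + h + q) ≤ n
  lower = begin
    2 * (2 * q + h + q)            ≡⟨ identity q h ⟩
    2 * h + q * 6                  ≤⟨ +-monoˡ-≤ (q * 6) (2*[m/2]≤m r) ⟩
    r + q * 6                      ≡⟨ m≡m%n+[m/n]*n n 6 ⟨
    n                              ∎
    where
    identity : ∀ q h → 2 * (2 * q + h + q) ≡ 2 * h + q * 6
    identity = solve-∀

-- The second bound holds for every n.
corollary2p2 : ((k n : ℕ) → 3 ≤ k → 2 ≤ n → 1 ≤ p k n)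
    × ((k n : ℕ) → 3 ≤ k → 12 ≤ n → n / 6 ≤ p k n)
corollary2p2 = 1≤p , λ k n 3≤k _ → n/6≤p k n 3≤k
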